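{- Let $d \geq 1$, let $B=\{b_1,\dots,b_d\}$ be a subset of $o_F$ with $d$ elements, and let $n$ be an integer such that every $f\in k[\![X,Y]\!]$ with $f(X,[b](X))\in X^nk[\![X]\!]$ for all $b\in B$ lies in $(X,Y)^d$. Let $m,\ell\ge0$ with $m+\ell < d$. Then there exist $\mu_{i,j} \in k$ for $1 \leq i \leq d$ and $0 \leq j \leq n-1$ such that for all $F(X,Y) \in k [\![X,Y]\!]$, the coefficient of $X^m Y^\ell$ in $F(X,Y)$ is equal to \[ \sum_{i=1}^d \sum_{j=0}^{n-1} \mu_{i,j} \cdot \langle F(X,[b_i](X)) \vert X^j \rangle. \]
   Context: $F$ is a finite extension of $\mathbf{Q}_p$ with ring of integers $o_F$, uniformizer $\pi$ and residue field $k$. $\operatorname{LT}$ is the Lubin–Tate formal group over $o_F$ attached to $\pi$ with a chosen coordinate $X$, and $[b](X)\in o_F[\![X]\!]$ its endomorphism attached to $b\in o_F$; in $k[\![X]\!]$, $[b](X)$ denotes its reduction modulo $\pi$. For $h\in k[\![X]\!]$, $\langle h(X)\vert X^j\rangle\in k$ denotes the coefficient of $X^j$ in $h$. -}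

module Defs where

open import Level using (Level; _⊔_)
open import Data.Nat using (ℕ; zero; suc; _∸_; _<_) renaming (_+_ to _+ℕ_)
open import Data.Fin using (Fin)
open import Data.List using (List)
open import Data.List.Membership.Setoid using ()
open import Data.List.Relation.Unary.Any using (Any)
open import Data.Product using (Σ; _×_)
open import Relation.Nullary using (¬_)
open import Relation.Binary.Definitions using (Decidable)
open import Algebra.Bundles using (CommutativeRing)

record FiniteField (c ℓ : Level) : Set (Level.suc (c ⊔ ℓ)) where
  field
    commRing : CommutativeRing c ℓ
  open CommutativeRing commRing public
  field
    1≉0      : ¬ (1# ≈ 0#)
    inverse  : ∀ x → ¬ (x ≈ 0#) → Σ Carrier (λ y → x * y ≈ 1#)
    _≟_      : Decidable _≈_
    elements : List Carrier
    complete : ∀ x → Any (λ y → x ≈ y) elements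

module PowerSeries {c ℓ : Level} (K : FiniteField c ℓ) where
  open FiniteField K public

  -- k[[X]] as coefficient sequences, k[[X,Y]] as doubly indexed ones:
  -- PS2 F a c is the coefficient of X^a Y^c.
  PS1 : Set c
  PS1 = ℕ → Carrier

  PS2 : Set c
  PS2 = ℕ → ℕ → Carrier

  sumTo : ℕ → (ℕ → Carrier) → Carrier
  sumTo zero    f = 0#
  sumTo (suc n) f = sumTo n f + f n

  sumFin : (n : ℕ) → (Fin n → Carrier) → Carrier
  sumFin zero    f = 0#
  sumFin (suc n) f = f Fin.zero + sumFin n (λ i → f (Fin.suc i))

  mul : PS1 → PS1 → PS1
  mul f g j = sumTo (suc j) (λ i → f i * g (j ∸ i))

  one : PS1
  one zero    = 1#
  one (suc _) = 0#

  pow : PS1 → ℕ → PS1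
  pow g zero    = one
  pow g (suc e) = mul g (pow g e)

  -- coefficient of X^j in F(X, g(X)), for g with zero constant term:
  -- Σ_{a ≤ j} Σ_{e ≤ j} F_{a,e} ⟨g^e | X^(j-a)⟩
  -- (terms with e > j - a vanish since g(0) = 0).
  compose : PS2 → PS1 → PS1
  compose F g j = sumTo (suc j) (λ a → sumTo (suc j) (λ e → F a e * pow g e (j ∸ a)))

  DivXPow : ℕ → PS1 → Set ℓ
  DivXPow n h = ∀ j → j < n → h j ≈ 0#

  InIdealPow : ℕ → PS2 → Set ℓ
  InIdealPow d F = ∀ a e → a +ℕ e < d → F a e ≈ 0#

-- The coefficient F(m,l) and the coefficients ⟨F(X,[b_i](X)) | X^j⟩ with j < n only involve
-- the coefficients of F in a box [0,T)², so they are linear functionals on k^(T×T). By the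
-- hypothesis (and m + l < d), F ↦ F(m,l) vanishes on the common kernel of the d·n functionals
-- F ↦ ⟨F(X,[b_i](X)) | X^j⟩, and over a field a functional vanishing on the common kernel of
-- finitely many others is a linear combination of them, by Gaussian elimination.
{-# OPTIONS --safe #-}
module Submission where

open import Defs
open import Level using (Level; _⊔_)
open import Data.Nat using (ℕ; _<_; _≤_) renaming (_+_ to _+ℕ_)
open import Data.Fin using (Fin; toℕ)
open import Data.Product using (Σ)
open import Function.Definitions using (Injective)
open import Relation.Binary.PropositionalEquality using (_≡_)

open import Algebra.Bundles using (Monoid; CommutativeSemiring; CommutativeRing)
open import Data.Nat as ℕ using (zero; suc; _∸_; z≤n; s≤s; s<s⁻¹)
open import Data.Nat.Properties
  using (≤-refl; m<n⇒m<1+n; m<1+n⇒m≤n; m≤n⇒m<n∨m≡n; m≤m+n; m≤n+m; ≤-trans)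
open import Data.Fin using (zero; suc; _↑ˡ_; _↑ʳ_; combine; remQuot; fromℕ<)
open import Data.Fin.Properties
  using (all?; ¬∀⟶∃¬; toℕ<n; toℕ-fromℕ<; fromℕ<-toℕ; toℕ-inject₁; toℕ-fromℕ;
         remQuot-combine; combine-remQuot)
open import Data.Product using (_,_; _×_; proj₁; proj₂; uncurry)
open import Data.Sum using (inj₁; inj₂)
open import Data.Vec.Functional using (Vector; _∷_; head; tail; init; last)
open import Function using (_∘_)
open import Relation.Binary.Definitions using (Decidable)
import Relation.Binary.PropositionalEquality as ≡
open import Relation.Nullary using (¬_; yes; no)

module MonoidSums {a ℓ} (M : Monoid a ℓ) where
  open Monoid M
  open import Algebra.Properties.Monoid.Sum M using (sum; sum-syntax)

  sum-↑ : ∀ m n (h : Vector Carrier (m +ℕ n)) →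
          sum h ≈ ∑[ i < m ] h (i ↑ˡ n) ∙ ∑[ j < n ] h (m ↑ʳ j)
  sum-↑ zero    n h = sym (identityˡ _)
  sum-↑ (suc m) n h = trans (∙-congˡ (sum-↑ m n (tail h))) (sym (assoc _ _ _))

  sum-combine : ∀ m n (h : Vector Carrier (m ℕ.* n)) →
                sum h ≈ ∑[ i < m ] ∑[ j < n ] h (combine i j)
  sum-combine zero    n h = refl
  sum-combine (suc m) n h =
    trans (sum-↑ n (m ℕ.* n) h) (∙-congˡ (sum-combine m n (λ q → h (n ↑ʳ q))))

module Pairing {c ℓ} (R : CommutativeSemiring c ℓ) where
  open CommutativeSemiring R hiding (zero)
  open import Algebra.Properties.Semiring.Sum semiring
  open import Relation.Binary.Reasoning.Setoid setoid

  ⟨_,_⟩ : ∀ {n} → Vector Carrier n → Vector Carrier n → Carrier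
  ⟨ u , v ⟩ = sum (λ q → u q * v q)

  unit : ∀ {n} → Fin n → Vector Carrier n
  unit zero    zero    = 1#
  unit zero    (suc _) = 0#
  unit (suc _) zero    = 0#
  unit (suc s) (suc q) = unit s q

  column : ∀ {m n} → (Fin m → Vector Carrier n) → Fin n → Vector Carrier m
  column φ q r = φ r q

  combination : ∀ {m n} → (Fin m → Vector Carrier n) → Vector Carrier m → Vector Carrier n
  combination φ μ q = ⟨ μ , column φ q ⟩

  ⟨⟩-congˡ : ∀ {n} {u u′ : Vector Carrier n} v → (∀ q → u q ≈ u′ q) → ⟨ u , v ⟩ ≈ ⟨ u′ , v ⟩
  ⟨⟩-congˡ v u≈u′ = sum-cong-≋ (λ q → *-congʳ (u≈u′ q))

  ⟨⟩-congʳ : ∀ {n} (u : Vector Carrier n) {v v′} → (∀ q → v q ≈ v′ q) → ⟨ u , v ⟩ ≈ ⟨ u , v′ ⟩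
  ⟨⟩-congʳ u v≈v′ = sum-cong-≋ (λ q → *-congˡ (v≈v′ q))

  ⟨⟩-comm : ∀ {n} (u v : Vector Carrier n) → ⟨ u , v ⟩ ≈ ⟨ v , u ⟩
  ⟨⟩-comm u v = sum-cong-≋ (λ q → *-comm (u q) (v q))

  ⟨⟩-zeroʳ : ∀ {n} (u v : Vector Carrier n) → (∀ q → v q ≈ 0#) → ⟨ u , v ⟩ ≈ 0#
  ⟨⟩-zeroʳ {n} u v v≈0 =
    trans (sum-cong-≋ (λ q → trans (*-congˡ (v≈0 q)) (zeroʳ (u q)))) (sum-replicate-zero n)

  ⟨⟩-unitʳ : ∀ {n} (u : Vector Carrier n) s → ⟨ u , unit s ⟩ ≈ u s
  ⟨⟩-unitʳ u zero    =
    trans (+-cong (*-identityʳ _) (⟨⟩-zeroʳ (tail u) _ (λ _ → refl))) (+-identityʳ _)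
  ⟨⟩-unitʳ u (suc s) = trans (+-cong (zeroʳ _) (⟨⟩-unitʳ (tail u) s)) (+-identityˡ _)

  ⟨⟩-unitˡ : ∀ {n} s (v : Vector Carrier n) → ⟨ unit s , v ⟩ ≈ v s
  ⟨⟩-unitˡ s v = trans (⟨⟩-comm (unit s) v) (⟨⟩-unitʳ v s)

  ⟨⟩-linearˡ : ∀ {n} (u w v : Vector Carrier n) x →
               ⟨ (λ q → u q + x * w q) , v ⟩ ≈ ⟨ u , v ⟩ + x * ⟨ w , v ⟩
  ⟨⟩-linearˡ u w v x = begin
    sum (λ q → (u q + x * w q) * v q)
      ≈⟨ sum-cong-≋ (λ q → trans (distribʳ (v q) (u q) (x * w q))
                                 (+-congˡ (*-assoc x (w q) (v q)))) ⟩
    sum (λ q → u q * v q + x * (w q * v q))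
      ≈⟨ ∑-distrib-+ (λ q → u q * v q) (λ q → x * (w q * v q)) ⟩
    ⟨ u , v ⟩ + sum (λ q → x * (w q * v q))
      ≈⟨ +-congˡ (*-distribˡ-sum x (λ q → w q * v q)) ⟨
    ⟨ u , v ⟩ + x * ⟨ w , v ⟩ ∎

  ⟨⟩-linearʳ : ∀ {n} (u v w : Vector Carrier n) x →
               ⟨ u , (λ q → v q + w q * x) ⟩ ≈ ⟨ u , v ⟩ + ⟨ u , w ⟩ * x
  ⟨⟩-linearʳ u v w x = begin
    sum (λ q → u q * (v q + w q * x))
      ≈⟨ sum-cong-≋ (λ q → trans (distribˡ (u q) (v q) (w q * x))
                                 (+-congˡ (sym (*-assoc (u q) (w q) x)))) ⟩
    sum (λ q → u q * v q + u q * w q * x)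
      ≈⟨ ∑-distrib-+ (λ q → u q * v q) (λ q → u q * w q * x) ⟩
    ⟨ u , v ⟩ + sum (λ q → u q * w q * x)
      ≈⟨ +-congˡ (*-distribʳ-sum x (λ q → u q * w q)) ⟨
    ⟨ u , v ⟩ + ⟨ u , w ⟩ * x ∎

  ⟨⟩-combinationˡ : ∀ {m n} (φ : Fin m → Vector Carrier n) μ v →
                    ⟨ combination φ μ , v ⟩ ≈ ⟨ μ , (λ r → ⟨ φ r , v ⟩) ⟩
  ⟨⟩-combinationˡ φ μ v = begin
    sum (λ q → sum (λ r → μ r * φ r q) * v q)
      ≈⟨ sum-cong-≋ (λ q → *-distribʳ-sum (v q) (λ r → μ r * φ r q)) ⟩
    sum (λ q → sum (λ r → μ r * φ r q * v q))
      ≈⟨ sum-cong-≋ (λ q → sum-cong-≋ (λ r → *-assoc (μ r) (φ r q) (v q))) ⟩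
    sum (λ q → sum (λ r → μ r * (φ r q * v q)))
      ≈⟨ ∑-comm (λ q r → μ r * (φ r q * v q)) ⟩
    sum (λ r → sum (λ q → μ r * (φ r q * v q)))
      ≈⟨ sum-cong-≋ (λ r → *-distribˡ-sum (μ r) (λ q → φ r q * v q)) ⟨
    ⟨ μ , (λ r → ⟨ φ r , v ⟩) ⟩ ∎

module Annihilators {c ℓ} (R : CommutativeRing c ℓ) where
  open CommutativeRing R hiding (zero)
  open Pairing commutativeSemiring
  open import Algebra.Properties.Ring ring
    using (-‿distribˡ-*; -‿distribʳ-*; [y-z]x≈yx-zx; //-rightDividesʳ; ⁻¹-anti-homo‿-; xyx⁻¹≈y)
  open import Data.Vec.Functional.Relation.Binary.Equality.Setoid setoid using (_≋_)
  open import Relation.Binary.Reasoning.Setoid setoid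

  VanishesOnKernel : ∀ {m n} → (Fin m → Vector Carrier n) → Vector Carrier n → Set (c ⊔ ℓ)
  VanishesOnKernel φ χ = ∀ v → (∀ r → ⟨ φ r , v ⟩ ≈ 0#) → ⟨ χ , v ⟩ ≈ 0#

  reduce : ∀ {n} → Vector Carrier n → Vector Carrier (suc n) → Vector Carrier n
  reduce κ u q = tail u q + head u * κ q

  ⟨⟩-reduce : ∀ {n} κ (u : Vector Carrier (suc n)) v → ⟨ u , ⟨ κ , v ⟩ ∷ v ⟩ ≈ ⟨ reduce κ u , v ⟩
  ⟨⟩-reduce κ u v = trans (+-comm _ _) (sym (⟨⟩-linearˡ (tail u) κ v (head u)))

  vanishesOnKernel-reduce : ∀ {m n} κ (φ : Fin m → Vector Carrier (suc n)) χ →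
    VanishesOnKernel φ χ → VanishesOnKernel (reduce κ ∘ φ) (reduce κ χ)
  vanishesOnKernel-reduce κ φ χ χ⊥ v φv≈0 =
    trans (sym (⟨⟩-reduce κ χ v))
          (χ⊥ (⟨ κ , v ⟩ ∷ v) (λ r → trans (⟨⟩-reduce κ (φ r) v) (φv≈0 r)))

  combination-reduce : ∀ {m n} κ (φ : Fin m → Vector Carrier (suc n)) ν q →
    combination (reduce κ ∘ φ) ν q ≈ combination (tail ∘ φ) ν q + ⟨ ν , column φ zero ⟩ * κ q
  combination-reduce κ φ ν q = ⟨⟩-linearʳ ν (column φ (suc q)) (column φ zero) (κ q)

  combination-zeroColumn : ∀ {m n} (φ : Fin m → Vector Carrier (suc n)) χ ν →
    (∀ r → φ r zero ≈ 0#) → VanishesOnKernel φ χ →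
    reduce (λ _ → 0#) χ ≋ combination (reduce (λ _ → 0#) ∘ φ) ν → χ ≋ combination φ ν
  combination-zeroColumn φ χ ν φ₀≈0 χ⊥ χ′≋ zero = begin
    χ zero                  ≈⟨ ⟨⟩-unitʳ χ zero ⟨
    ⟨ χ , unit zero ⟩       ≈⟨ χ⊥ (unit zero) (λ r → trans (⟨⟩-unitʳ (φ r) zero) (φ₀≈0 r)) ⟩
    0#                      ≈⟨ ⟨⟩-zeroʳ ν (column φ zero) φ₀≈0 ⟨
    ⟨ ν , column φ zero ⟩   ∎
  combination-zeroColumn φ χ ν φ₀≈0 χ⊥ χ′≋ (suc q) = begin
    χ (suc q)                                                ≈⟨ x+y*0≈x _ _ ⟨
    χ (suc q) + χ zero * 0#                                  ≈⟨ χ′≋ q ⟩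
    combination (reduce (λ _ → 0#) ∘ φ) ν q                  ≈⟨ combination-reduce _ φ ν q ⟩
    combination (tail ∘ φ) ν q + ⟨ ν , column φ zero ⟩ * 0#  ≈⟨ x+y*0≈x _ _ ⟩
    ⟨ ν , column φ (suc q) ⟩                                 ∎
    where
    x+y*0≈x : ∀ x y → x + y * 0# ≈ x
    x+y*0≈x x y = trans (+-congˡ (zeroʳ y)) (+-identityʳ x)

  -- κ makes the pivot row reduce to zero, so the first coordinate of χ, lost in the
  -- reduction, is restored by adding a multiple of the pivot row.
  module Pivot {m n} (φ : Fin m → Vector Carrier (suc n)) (s : Fin m) {ι}
               (φₛ₀ι≈1 : φ s zero * ι ≈ 1#) where
    κ : Vector Carrier n
    κ q = - (ι * φ s (suc q))

    module _ (χ : Vector Carrier (suc n)) (ν : Vector Carrier m) where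
      S t : Carrier
      S = ⟨ ν , column φ zero ⟩
      t = (χ zero - S) * ι

      μ : Vector Carrier m
      μ r = ν r + t * unit s r

      shift : ∀ q → combination φ μ q ≈ ⟨ ν , column φ q ⟩ + t * φ s q
      shift q = trans (⟨⟩-linearˡ ν (unit s) (column φ q) t)
                      (+-congˡ (*-congˡ (⟨⟩-unitˡ s (column φ q))))

      t*φₛ₀ : t * φ s zero ≈ χ zero - S
      t*φₛ₀ = begin
        (χ zero - S) * ι * φ s zero    ≈⟨ *-assoc _ ι (φ s zero) ⟩
        (χ zero - S) * (ι * φ s zero)  ≈⟨ *-congˡ (trans (*-comm ι (φ s zero)) φₛ₀ι≈1) ⟩
        (χ zero - S) * 1#              ≈⟨ *-identityʳ _ ⟩
        χ zero - S                     ∎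

      [S-χ₀]κ : ∀ q → (S - χ zero) * κ q ≈ t * φ s (suc q)
      [S-χ₀]κ q = begin
        (S - χ zero) * - (ι * b)       ≈⟨ -‿distribʳ-* _ _ ⟨
        - ((S - χ zero) * (ι * b))     ≈⟨ -‿distribˡ-* _ _ ⟩
        - (S - χ zero) * (ι * b)       ≈⟨ *-congʳ (⁻¹-anti-homo‿- S (χ zero)) ⟩
        (χ zero - S) * (ι * b)         ≈⟨ *-assoc _ ι b ⟨
        t * b                          ∎
        where
        b : Carrier
        b = φ s (suc q)

      combination-pivot : reduce κ χ ≋ combination (reduce κ ∘ φ) ν →
                          χ ≋ combination φ μ
      combination-pivot χ′≋ zero = begin
        χ zero                ≈⟨ xyx⁻¹≈y S (χ zero) ⟨
        S + χ zero - S        ≈⟨ +-assoc S (χ zero) (- S) ⟩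
        S + (χ zero - S)      ≈⟨ +-congˡ t*φₛ₀ ⟨
        S + t * φ s zero      ≈⟨ shift zero ⟨
        combination φ μ zero  ∎
      combination-pivot χ′≋ (suc q) = begin
        χ (suc q)                                ≈⟨ //-rightDividesʳ (χ zero * κ q) (χ (suc q)) ⟨
        χ (suc q) + χ zero * κ q - χ zero * κ q
          ≈⟨ +-congʳ (trans (χ′≋ q) (combination-reduce κ φ ν q)) ⟩
        C + S * κ q - χ zero * κ q               ≈⟨ +-assoc C _ _ ⟩
        C + (S * κ q - χ zero * κ q)             ≈⟨ +-congˡ ([y-z]x≈yx-zx (κ q) S (χ zero)) ⟨
        C + (S - χ zero) * κ q                   ≈⟨ +-congˡ ([S-χ₀]κ q) ⟩
        C + t * φ s (suc q)                      ≈⟨ shift (suc q) ⟨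
        combination φ μ (suc q)                  ∎
        where
        C : Carrier
        C = ⟨ ν , column φ (suc q) ⟩

  module _ (_≟_ : Decidable _≈_) (inverse : ∀ x → ¬ x ≈ 0# → Σ Carrier (λ y → x * y ≈ 1#)) where
    vanishesOnKernel⇒combination : ∀ {m n} (φ : Fin m → Vector Carrier n) χ →
      VanishesOnKernel φ χ → Σ (Vector Carrier m) (λ μ → χ ≋ combination φ μ)
    vanishesOnKernel⇒combination {n = zero} φ χ _ = (λ _ → 0#) , λ ()
    vanishesOnKernel⇒combination {m} {suc n} φ χ χ⊥ with all? (λ r → φ r zero ≟ 0#)
    ... | yes φ₀≈0 =
      let ν , χ′≋ = vanishesOnKernel⇒combination _ _ (vanishesOnKernel-reduce (λ _ → 0#) φ χ χ⊥)
      in ν , combination-zeroColumn φ χ ν φ₀≈0 χ⊥ χ′≋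
    ... | no φ₀≉0 =
      let s , φₛ₀≉0 = ¬∀⟶∃¬ m _ (λ r → φ r zero ≟ 0#) φ₀≉0
          ι , φₛ₀ι≈1 = inverse (φ s zero) φₛ₀≉0
          open Pivot φ s φₛ₀ι≈1
          ν , χ′≋ = vanishesOnKernel⇒combination _ _ (vanishesOnKernel-reduce κ φ χ χ⊥)
      in μ χ ν , combination-pivot χ ν χ′≋

module Composition {c ℓ} (K : FiniteField c ℓ) where
  open PowerSeries K hiding (zero)
  open Pairing commutativeSemiring
  open Annihilators commRing
  open import Algebra.Properties.Semiring.Sum semiring
    using (sum; sum-syntax; sum-cong-≋; sum-cong-≗; sum-init-last)
  open MonoidSums +-monoid
  open import Data.Vec.Functional.Relation.Binary.Equality.Setoid setoid using (_≋_)
  open import Relation.Binary.Reasoning.Setoid setoid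

  sumFin≡sum : ∀ n (f : Vector Carrier n) → sumFin n f ≡ sum f
  sumFin≡sum zero    f = ≡.refl
  sumFin≡sum (suc n) f = ≡.cong (f zero +_) (sumFin≡sum n (tail f))

  sumTo≈sum : ∀ n (f : ℕ → Carrier) → sumTo n f ≈ ∑[ i < n ] f (toℕ i)
  sumTo≈sum zero    f = refl
  sumTo≈sum (suc n) f = begin
    sumTo n f + f n                 ≈⟨ +-congʳ (sumTo≈sum n f) ⟩
    ∑[ i < n ] f (toℕ i) + f n      ≡⟨ ≡.cong₂ _+_ (sum-cong-≗ {n} (≡.cong f ∘ ≡.sym ∘ toℕ-inject₁))
                                                   (≡.cong f (≡.sym (toℕ-fromℕ n))) ⟩
    sum (init f′) + last f′         ≈⟨ sum-init-last f′ ⟨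
    sum f′                          ∎
    where
    f′ : Vector Carrier (suc n)
    f′ i = f (toℕ i)

  sumTo-cong< : ∀ n {f g : ℕ → Carrier} → (∀ a → a < n → f a ≈ g a) → sumTo n f ≈ sumTo n g
  sumTo-cong< zero    f≈g = refl
  sumTo-cong< (suc n) f≈g =
    +-cong (sumTo-cong< n (λ a a<n → f≈g a (m<n⇒m<1+n a<n))) (f≈g n ≤-refl)

  sumTo-trailingZeros : ∀ {s} T {f : ℕ → Carrier} → s ≤ T → (∀ a → s ≤ a → f a ≈ 0#) →
                        sumTo T f ≈ sumTo s f
  sumTo-trailingZeros zero    z≤n   f≈0 = refl
  sumTo-trailingZeros {s} (suc T) s≤1+T f≈0 with m≤n⇒m<n∨m≡n s≤1+T
  ... | inj₁ s<1+T = trans (+-cong (sumTo-trailingZeros T s≤T f≈0) (f≈0 T s≤T)) (+-identityʳ _)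
    where
    s≤T : s ≤ T
    s≤T = m<1+n⇒m≤n s<1+T
  ... | inj₂ ≡.refl = refl

  toSequence : ∀ {n} → Vector Carrier n → ℕ → Carrier
  toSequence {zero}  v a       = 0#
  toSequence {suc n} v zero    = head v
  toSequence {suc n} v (suc a) = toSequence (tail v) a

  toSequence-< : ∀ {n a} (v : Vector Carrier n) (a<n : a < n) → toSequence v a ≡ v (fromℕ< a<n)
  toSequence-< {suc n} {zero}  v a<n = ≡.refl
  toSequence-< {suc n} {suc a} v a<n = toSequence-< (tail v) (s<s⁻¹ a<n)

  toSequence-≥ : ∀ {n a} (v : Vector Carrier n) → n ≤ a → toSequence v a ≡ 0#
  toSequence-≥ {zero}          v n≤a       = ≡.refl
  toSequence-≥ {suc n} {suc a} v (s≤s n≤a) = toSequence-≥ (tail v) n≤a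

  extendByZero : ∀ {T} → (Fin T → Fin T → Carrier) → PS2
  extendByZero M a e = toSequence (λ a′ → toSequence (M a′) e) a

  extendByZero-< : ∀ {T a e} M (a<T : a < T) (e<T : e < T) →
                   extendByZero M a e ≡ M (fromℕ< a<T) (fromℕ< e<T)
  extendByZero-< {e = e} M a<T e<T =
    ≡.trans (toSequence-< (λ a′ → toSequence (M a′) e) a<T) (toSequence-< (M (fromℕ< a<T)) e<T)

  extendByZero-≥ˡ : ∀ {T a e} M → T ≤ a → extendByZero M a e ≡ 0#
  extendByZero-≥ˡ {e = e} M T≤a = toSequence-≥ (λ a′ → toSequence (M a′) e) T≤a

  extendByZero-≥ʳ : ∀ {T a e} M → a < T → T ≤ e → extendByZero M a e ≡ 0#
  extendByZero-≥ʳ {e = e} M a<T T≤e =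
    ≡.trans (toSequence-< (λ a′ → toSequence (M a′) e) a<T) (toSequence-≥ (M (fromℕ< a<T)) T≤e)

  extendByZero-toℕ : ∀ {T} M (a e : Fin T) → extendByZero M (toℕ a) (toℕ e) ≡ M a e
  extendByZero-toℕ M a e = ≡.trans (extendByZero-< M (toℕ<n a) (toℕ<n e))
                                   (≡.cong₂ M (fromℕ<-toℕ a _) (fromℕ<-toℕ e _))

  truncate : ℕ → PS2 → PS2
  truncate s w = extendByZero {s} (λ a e → w (toℕ a) (toℕ e))

  truncate-< : ∀ {s a e} w → a < s → e < s → truncate s w a e ≡ w a e
  truncate-< w a<s e<s = ≡.trans (extendByZero-< (λ a e → w (toℕ a) (toℕ e)) a<s e<s)
                                 (≡.cong₂ w (toℕ-fromℕ< a<s) (toℕ-fromℕ< e<s))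

  sumTo²-truncate : ∀ {s} T (w G : PS2) → s ≤ T →
    sumTo T (λ a → sumTo T (λ e → truncate s w a e * G a e))
      ≈ sumTo s (λ a → sumTo s (λ e → w a e * G a e))
  sumTo²-truncate {s} T w G s≤T = begin
    sumTo T (λ a → sumTo T (λ e → truncate s w a e * G a e))
      ≈⟨ sumTo-trailingZeros T s≤T (λ a s≤a →
           sumTo-trailingZeros T z≤n (λ e _ → zero* (extendByZero-≥ˡ w′ s≤a))) ⟩
    sumTo s (λ a → sumTo T (λ e → truncate s w a e * G a e))
      ≈⟨ sumTo-cong< s (λ a a<s → begin
           sumTo T (λ e → truncate s w a e * G a e)
             ≈⟨ sumTo-trailingZeros T s≤T (λ e s≤e → zero* (extendByZero-≥ʳ w′ a<s s≤e)) ⟩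
           sumTo s (λ e → truncate s w a e * G a e)
             ≈⟨ sumTo-cong< s (λ e e<s → *-congʳ (reflexive (truncate-< w a<s e<s))) ⟩
           sumTo s (λ e → w a e * G a e) ∎) ⟩
    sumTo s (λ a → sumTo s (λ e → w a e * G a e)) ∎
    where
    w′ : Fin s → Fin s → Carrier
    w′ a e = w (toℕ a) (toℕ e)

    zero* : ∀ {x y} → x ≡ 0# → x * y ≈ 0#
    zero* ≡.refl = zeroˡ _

  flatten : ∀ T → PS2 → Vector Carrier (T ℕ.* T)
  flatten T G q = uncurry (λ a e → G (toℕ a) (toℕ e)) (remQuot {T} T q)

  flatten-combine : ∀ T G (a e : Fin T) → flatten T G (combine a e) ≡ G (toℕ a) (toℕ e)
  flatten-combine T G a e =
    ≡.cong (uncurry (λ a e → G (toℕ a) (toℕ e))) (remQuot-combine {T} {T} a e)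

  unflatten : ∀ T → Vector Carrier (T ℕ.* T) → PS2
  unflatten T v = extendByZero {T} (λ a e → v (combine a e))

  flatten-unflatten : ∀ T (v : Vector Carrier (T ℕ.* T)) q → flatten T (unflatten T v) q ≡ v q
  flatten-unflatten T v q =
    ≡.trans (extendByZero-toℕ (λ a e → v (combine a e)) (proj₁ aₑ) (proj₂ aₑ))
            (≡.cong v (combine-remQuot {T} T q))
    where
    aₑ : Fin T × Fin T
    aₑ = remQuot {T} T q

  ⟨flatten,flatten⟩ : ∀ T (w G : PS2) →
    ⟨ flatten T w , flatten T G ⟩ ≈ sumTo T (λ a → sumTo T (λ e → w a e * G a e))
  ⟨flatten,flatten⟩ T w G = begin
    ⟨ flatten T w , flatten T G ⟩
      ≈⟨ sum-combine T T _ ⟩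
    ∑[ a < T ] ∑[ e < T ] (flatten T w (combine a e) * flatten T G (combine a e))
      ≡⟨ sum-cong-≗ (λ a → sum-cong-≗ (λ e →
           ≡.cong₂ _*_ (flatten-combine T w a e) (flatten-combine T G a e))) ⟩
    ∑[ a < T ] ∑[ e < T ] (w (toℕ a) (toℕ e) * G (toℕ a) (toℕ e))
      ≈⟨ trans (sumTo≈sum T (λ a → sumTo T (λ e → w a e * G a e)))
                 (sum-cong-≋ {T} (λ a → sumTo≈sum T (λ e → w (toℕ a) e * G (toℕ a) e))) ⟨
    sumTo T (λ a → sumTo T (λ e → w a e * G a e)) ∎

  composeWeight : PS1 → ℕ → PS2
  composeWeight g j = truncate (suc j) (λ a e → pow g e (j ∸ a))

  compose≈⟨flatten⟩ : ∀ T g j (G : PS2) → suc j ≤ T →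
    compose G g j ≈ ⟨ flatten T (composeWeight g j) , flatten T G ⟩
  compose≈⟨flatten⟩ T g j G j<T = begin
    compose G g j
      ≈⟨ sumTo-cong< (suc j) (λ a _ → sumTo-cong< (suc j) (λ e _ →
           *-comm (G a e) (pow g e (j ∸ a)))) ⟩
    sumTo (suc j) (λ a → sumTo (suc j) (λ e → pow g e (j ∸ a) * G a e))
      ≈⟨ sumTo²-truncate T (λ a e → pow g e (j ∸ a)) G j<T ⟨
    sumTo T (λ a → sumTo T (λ e → composeWeight g j a e * G a e))
      ≈⟨ ⟨flatten,flatten⟩ T (composeWeight g j) G ⟨
    ⟨ flatten T (composeWeight g j) , flatten T G ⟩ ∎

  module Rows {d} (g : Fin d → PS1) (n T : ℕ) (n≤T : n ≤ T) where
    rowAt : Fin d → Fin n → Vector Carrier (T ℕ.* T)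
    rowAt i j = flatten T (composeWeight (g i) (toℕ j))

    row : Fin (d ℕ.* n) → Vector Carrier (T ℕ.* T)
    row r = uncurry rowAt (remQuot {d} n r)

    row-combine : ∀ i j → row (combine i j) ≡ rowAt i j
    row-combine i j = ≡.cong (uncurry rowAt) (remQuot-combine i j)

    compose≈⟨row⟩ : ∀ F i (j : Fin n) →
                    compose F (g i) (toℕ j) ≈ ⟨ row (combine i j) , flatten T F ⟩
    compose≈⟨row⟩ F i j =
      trans (compose≈⟨flatten⟩ T (g i) (toℕ j) F (≤-trans (toℕ<n j) n≤T))
            (reflexive (≡.cong (λ u → ⟨ u , flatten T F ⟩) (≡.sym (row-combine i j))))

    kernel⇒DivXPow : ∀ v → (∀ r → ⟨ row r , v ⟩ ≈ 0#) →
                     ∀ i → DivXPow n (compose (unflatten T v) (g i))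
    kernel⇒DivXPow v v⊥ i j j<n = begin
      compose f (g i) j                ≡⟨ ≡.cong (compose f (g i)) (toℕ-fromℕ< j<n) ⟨
      compose f (g i) (toℕ j′)         ≈⟨ compose≈⟨row⟩ f i j′ ⟩
      ⟨ row r , flatten T f ⟩          ≈⟨ ⟨⟩-congʳ (row r) (reflexive ∘ flatten-unflatten T v) ⟩
      ⟨ row r , v ⟩                    ≈⟨ v⊥ r ⟩
      0#                               ∎
      where
      f : PS2
      f = unflatten T v
      j′ : Fin n
      j′ = fromℕ< j<n
      r : Fin (d ℕ.* n)
      r = combine i j′

    ⟨μ,rows⟩ : ∀ μ F → ⟨ μ , (λ r → ⟨ row r , flatten T F ⟩) ⟩
               ≈ sumFin d (λ i → sumFin n (λ j → μ (combine i j) * compose F (g i) (toℕ j)))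
    ⟨μ,rows⟩ μ F = begin
      ⟨ μ , (λ r → ⟨ row r , flatten T F ⟩) ⟩
        ≈⟨ sum-combine d n _ ⟩
      ∑[ i < d ] ∑[ j < n ] (μ (combine i j) * ⟨ row (combine i j) , flatten T F ⟩)
        ≈⟨ sum-cong-≋ {d} (λ i → sum-cong-≋ {n} (λ j → *-congˡ (compose≈⟨row⟩ F i j))) ⟨
      ∑[ i < d ] ∑[ j < n ] (μ (combine i j) * compose F (g i) (toℕ j))
        ≡⟨ ≡.trans (sumFin≡sum d _) (sum-cong-≗ {d} (λ i → sumFin≡sum n _)) ⟨
      sumFin d (λ i → sumFin n (λ j → μ (combine i j) * compose F (g i) (toℕ j))) ∎

  coefficient∈span-of-compose : ∀ {d} (g : Fin d → PS1) (n m l : ℕ) →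
    (∀ f → (∀ i → DivXPow n (compose f (g i))) → f m l ≈ 0#) →
    Σ (Fin d → Fin n → Carrier) λ μ →
      ∀ F → F m l ≈ sumFin d (λ i → sumFin n (λ j → μ i j * compose F (g i) (toℕ j)))
  coefficient∈span-of-compose {d} g n m l vanishes = (λ i j → μ (combine i j)) , λ F → begin
    F m l                                        ≡⟨ coefficient F ⟩
    flatten T F (combine m′ l′)                  ≈⟨ ⟨⟩-unitˡ (combine m′ l′) (flatten T F) ⟨
    ⟨ unit (combine m′ l′) , flatten T F ⟩       ≈⟨ ⟨⟩-congˡ (flatten T F) χ≋ ⟩
    ⟨ combination row μ , flatten T F ⟩          ≈⟨ ⟨⟩-combinationˡ row μ (flatten T F) ⟩
    ⟨ μ , (λ r → ⟨ row r , flatten T F ⟩) ⟩      ≈⟨ ⟨μ,rows⟩ μ F ⟩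
    sumFin d (λ i → sumFin n (λ j → μ (combine i j) * compose F (g i) (toℕ j))) ∎
    where
    T : ℕ
    T = n +ℕ suc (m +ℕ l)
    open Rows g n T (m≤m+n n _)
    m′ l′ : Fin T
    m′ = fromℕ< (≤-trans (s≤s (m≤m+n m l)) (m≤n+m _ n))
    l′ = fromℕ< (≤-trans (s≤s (m≤n+m l m)) (m≤n+m _ n))

    coefficient : ∀ G → G m l ≡ flatten T G (combine m′ l′)
    coefficient G =
      ≡.sym (≡.trans (flatten-combine T G m′ l′) (≡.cong₂ G (toℕ-fromℕ< _) (toℕ-fromℕ< _)))

    target⊥ : VanishesOnKernel row (unit (combine m′ l′))
    target⊥ v v⊥ = begin
      ⟨ unit (combine m′ l′) , v ⟩            ≈⟨ ⟨⟩-unitˡ (combine m′ l′) v ⟩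
      v (combine m′ l′)                      ≡⟨ flatten-unflatten T v _ ⟨
      flatten T (unflatten T v) (combine m′ l′) ≡⟨ coefficient (unflatten T v) ⟨
      unflatten T v m l                      ≈⟨ vanishes (unflatten T v) (kernel⇒DivXPow v v⊥) ⟩
      0#                                     ∎

    solution : Σ (Vector Carrier (d ℕ.* n)) (λ μ → unit (combine m′ l′) ≋ combination row μ)
    solution = vanishesOnKernel⇒combination _≟_ inverse row (unit (combine m′ l′)) target⊥

    μ : Vector Carrier (d ℕ.* n)
    μ = proj₁ solution

    χ≋ : unit (combine m′ l′) ≋ combination row μ
    χ≋ = proj₂ solution

proposition4p4 : {c ℓ o : Level} (k : FiniteField c ℓ) →
    let open PowerSeries k in
    -- o_F (abstract) and the reductions mod π of the Lubin–Tate endomorphisms [b](X)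
    (OF : Set o) (LT : OF → PS1) → (∀ b → LT b 0 ≈ 0#) →
    (d : ℕ) → 1 ≤ d →
    (B : Fin d → OF) → Injective _≡_ _≡_ B →
    (n : ℕ) →
    (∀ (f : PS2) → (∀ (i : Fin d) → DivXPow n (compose f (LT (B i)))) → InIdealPow d f) →
    (m l : ℕ) → m +ℕ l < d →
    Σ (Fin d → Fin n → Carrier) λ μ →
      ∀ (F : PS2) →
        F m l ≈ sumFin d (λ i → sumFin n (λ j → μ i j * compose F (LT (B i)) (toℕ j)))
proposition4p4 k OF LT _ d _ B _ n inIdeal m l m+l<d =
  Composition.coefficient∈span-of-compose k (LT ∘ B) n m l
    (λ f divisible → inIdeal f divisible m l m+l<d)
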